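{- Let $\mathcal{N}$ be a sound, weakly deterministic negotiation arena with atom set $N=N_1\cup N_2$, initial atom $n_0$ and final atom $n_f$. Then Player 1 has a winning strategy in the termination game on $\mathcal{N}$ if and only if $n_0\in\mathcal{A}$, where $\mathcal{A}$ is the attractor of $n_f$.
   Context: A negotiation over a finite set of agents consists of a finite set $N$ of atoms, each atom $n$ having a nonempty set of parties $P_n$ and a finite nonempty set of outcomes $R_n$, an initial atom $n_0$ and a final atom $n_f$ in which every agent participates, and a transition function $\mathcal{X}$ assigning to each triple $(n,a,r)$ with $a\in P_n$, $r\in R_n$ a set of atoms $\mathcal{X}(n,a,r)\subseteq N$, which is empty iff $n=n_f$. A marking maps agents to sets of atoms; the initial marking has $x_0(a)=\{n_0\}$ and the final marking $x_f(a)=\emptyset$ for all $a$. A marking $x$ enables $n$ if $n\in x(a)$ for all $a\in P_n$; then $(n,r)$ for $r\in R_n$ may occur, yielding $x'$ with $x'(a)=\mathcal{X}(n,a,r)$ for $a\in P_n$ and $x'(a)=x(a)$ otherwise. The negotiation is sound if (a) every atom is enabled at some marking reachable from $x_0$, and (b) every occurrence sequence from $x_0$ either leads to $x_f$ or can be extended to one that leads to $x_f$. An agent $a$ is deterministic if for every atom $n\neq n_f$ with $a\in P_n$ and every $r\in R_n$, $\mathcal{X}(n,a,r)$ is a singleton. The negotiation is weakly deterministic if for every $(n,a,r)$ there is a deterministic agent $b$ that is a party of every atom in $\mathcal{X}(n,a,r)$. A set $S$ of atoms is independent if $P_n\cap P_{n'}=\emptyset$ for distinct $n,n'\in S$. A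 negotiation arena is a negotiation with $N$ partitioned into $N_1$ and $N_2$. The game has three players: Player 1, Player 2 and Scheduler. Starting at $x_0$, at each step Scheduler chooses a nonempty independent set $S$ of atoms enabled at the current marking; then Player 1 and Player 2, independently, choose an outcome for each atom in $S\cap N_1$, resp. $S\cap N_2$; these outcomes occur and the game moves to the resulting marking. The play ends when a marking enabling no atom is reached, otherwise it is infinite. A strategy for Player $j$ maps each finite play history together with the set $S$ chosen next by Scheduler to a choice of outcomes for the atoms of $S\cap N_j$; it is winning if Player $j$ wins every play consistent with it. In the termination game Player 1 wins a play iff the play ends with $n_f$ occurring; otherwise Player 2 wins. For an atom $n$ let $P_{n,det}$ be the set of deterministic agents in $P_n$; for $n\neq n_f$ and deterministic $a\in P_n$ write $\mathcal{X}(n,a,r)$ also for the unique atom it contains. The attractor of $n_f$ is $\mathcal{A}=\bigcup_{k\ge0}\mathcal{A}_k$ where $\mathcal{A}_0=\{n_f\}$ and $\mathcal{A}_{k+1}=\mathcal{A}_k\cup\{n\in N_1:\exists r\in R_n\,\forall a\in P_{n,det}:\mathcal{X}(n,a,r)\in\mathcal{A}_k\}\cup\{n\in N_2:\forall r\in R_n\,\forall a\in P_{n,det}:\mathcal{X}(n,a,r)\in\mathcal{A}_k\}$. -}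

module Defs where

open import Data.Nat using (ℕ; zero; suc; NonZero)
open import Data.Fin using (Fin)
open import Data.Fin.Subset using (Subset; _∈_; _∉_; ⁅_⁆; Nonempty; Empty) renaming (⊥ to ∅)
open import Data.Bool using (Bool; true; false; if_then_else_)
open import Data.Vec using (lookup)
open import Data.List using (List; []; _∷_; _++_; [_]; foldr; foldl; allFin; applyUpTo)
open import Data.Product using (Σ; ∃; _×_; _,_; proj₁; proj₂)
open import Data.Sum using (_⊎_)
open import Data.Unit using (⊤)
open import Relation.Nullary using (¬_)
open import Relation.Binary.PropositionalEquality using (_≡_; _≢_)
open import Function.Bundles using (_⇔_)

data Player : Set where
  P1 P2 : Player

-- P n : parties of atom n, R n : number of outcomes of n (outcomes Fin (R n)),
-- X n a r : the set of atoms 𝒳(n,a,r) (only meaningful for a ∈ P n),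
-- owner n : which of N₁ / N₂ the atom n belongs to.
record Arena : Set where
  field
    k m     : ℕ
    P       : Fin m → Subset k
    R       : Fin m → ℕ
    n₀ nf   : Fin m
    X       : (n : Fin m) → Fin k → Fin (R n) → Subset m
    owner   : Fin m → Player
    P-nonempty : ∀ n → Nonempty (P n)
    R-nonzero  : ∀ n → NonZero (R n)
    n₀-all     : ∀ a → a ∈ P n₀
    nf-all     : ∀ a → a ∈ P nf
    X-empty⇔nf : ∀ n a (r : Fin (R n)) → a ∈ P n → (Empty (X n a r) ⇔ (n ≡ nf))

module _ (𝒩 : Arena) where
  open Arena 𝒩

  Agent Atom : Set
  Agent = Fin k
  Atom  = Fin m

  Marking : Set
  Marking = Agent → Subset m

  x₀ : Marking
  x₀ a = ⁅ n₀ ⁆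

  IsFinal : Marking → Set
  IsFinal x = ∀ a → x a ≡ ∅

  Enables : Marking → Atom → Set
  Enables x n = ∀ a → a ∈ P n → n ∈ x a

  fire : Marking → (n : Atom) → Fin (R n) → Marking
  fire x n r a = if lookup (P n) a then X n a r else x a

  data Reach : Marking → Marking → Set where
    done : ∀ {x} → Reach x x
    occ  : ∀ {x y} (n : Atom) (r : Fin (R n)) →
           Enables x n → Reach (fire x n r) y → Reach x y

  Sound : Set
  Sound = (∀ n → ∃ λ x → Reach x₀ x × Enables x n)
        × (∀ x → Reach x₀ x → ∃ λ y → Reach x y × IsFinal y)

  Deterministic : Agent → Set
  Deterministic a = ∀ n → n ≢ nf → a ∈ P n → ∀ (r : Fin (R n)) →
                    ∃ λ n' → X n a r ≡ ⁅ n' ⁆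

  WeaklyDeterministic : Set
  WeaklyDeterministic = ∀ n a (r : Fin (R n)) → a ∈ P n →
    ∃ λ b → Deterministic b × (∀ n' → n' ∈ X n a r → b ∈ P n')

  Independent : Subset m → Set
  Independent S = ∀ n n' → n ∈ S → n' ∈ S → n ≢ n' → ∀ a → a ∈ P n → a ∉ P n'

  -- Attractor.  For deterministic a ∈ P n (n ≠ n_f), "𝒳(n,a,r) ∈ 𝒜ₖ" is
  -- written: the unique atom n' with 𝒳(n,a,r) = {n'} lies in 𝒜ₖ.
  AllDetSucc : ℕ → (n : Atom) → Fin (R n) → Set
  Attr : ℕ → Atom → Set
  Attr zero    n = n ≡ nf
  Attr (suc i) n = Attr i n
                 ⊎ (owner n ≡ P1 × Σ (Fin (R n)) λ r → AllDetSucc i n r)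
                 ⊎ (owner n ≡ P2 × ∀ (r : Fin (R n)) → AllDetSucc i n r)
  AllDetSucc i n r = ∀ a → a ∈ P n → Deterministic a →
                     ∀ n' → X n a r ≡ ⁅ n' ⁆ → Attr i n'

  InAttractor : Atom → Set
  InAttractor n = ∃ λ i → Attr i n

  -- The termination game.
  -- A move is Scheduler's set S together with an outcome for every atom
  -- (only the outcomes of atoms in S matter).
  Choice : Set
  Choice = (n : Atom) → Fin (R n)

  Move : Set
  Move = Σ (Subset m) λ _ → Choice

  -- simultaneous occurrence of the atoms of S (independent, so order is irrelevant)
  stepM : Marking → Move → Marking
  stepM x (S , c) = foldr (λ n y → if lookup S n then fire y n (c n) else y) x (allFin m)

  run : List Move → Marking
  run h = foldl stepM x₀ h

  Legal : Marking → Subset m → Set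
  Legal x S = Nonempty S × Independent S × (∀ n → n ∈ S → Enables x n)

  Dead : Marking → Set
  Dead x = ∀ n → ¬ Enables x n

  -- strategy of Player 1: history and Scheduler's next set ↦ outcomes
  -- (only the outcomes of atoms in S ∩ N₁ are used)
  Strategy : Set
  Strategy = List Move → Subset m → Choice

  Agrees : Strategy → List Move → Move → Set
  Agrees σ h (S , c) = ∀ n → n ∈ S → owner n ≡ P1 → c n ≡ σ h S n

  ConsistentFrom : Strategy → List Move → List Move → Set
  ConsistentFrom σ past []         = ⊤
  ConsistentFrom σ past (mv ∷ fut) =
    Legal (run past) (proj₁ mv) × Agrees σ past mv × ConsistentFrom σ (past ++ [ mv ]) fut

  InfiniteConsistent : Strategy → (ℕ → Move) → Set
  InfiniteConsistent σ ms = ∀ i →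
    Legal (run (applyUpTo ms i)) (proj₁ (ms i)) × Agrees σ (applyUpTo ms i) (ms i)

  EndsWithNf : List Move → Set
  EndsWithNf h = ∃ λ init → ∃ λ mv → h ≡ init ++ [ mv ] × nf ∈ proj₁ mv

  Winning : Strategy → Set
  Winning σ = (∀ ms → ¬ InfiniteConsistent σ ms)
            × (∀ h → ConsistentFrom σ [] h → Dead (run h) → EndsWithNf h)

  Player1Wins : Set
  Player1Wins = ∃ λ σ → Winning σ

module Submission where

-- The hierarchy Attr 0 ⊆ Attr 1 ⊆ … of attractor levels is decidable and
-- grows strictly until it stabilises, so there is a level s with 𝒜 = Attr s
-- (module Attractor).
--
-- (⇐) Player 1 plays positionally, choosing at each atom of 𝒜 an outcome
--     that sends every deterministic party to an atom of smaller rank (least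
--     level).  The sum over deterministic agents of the ranks of their marked
--     atoms strictly decreases at each step, so every play is finite, and in a
--     sound negotiation a play can only get stuck right after n_f occurred
--     (modules Plays and AttractorStrategy).
-- (⇒) If n₀ ∉ 𝒜, Scheduler fires one enabled atom at a time and Player 2
--     answers with outcomes letting some deterministic agent leave 𝒜.  Some
--     deterministic agent then always marks exactly one atom outside 𝒜, so by
--     soundness some atom is always enabled and the play is infinite
--     (module Spoiler).
--
-- Weak determinism provides a deterministic party for every marked atom,
-- which is what makes the potential decrease in (⇐).

open import Defs
import Data.Bool as Bool
open import Data.Bool using (true; false; if_then_else_)
open import Data.Empty using (⊥-elim)
open import Data.Fin using (Fin; zero; suc; _≟_; fromℕ<)
open import Data.Fin.Properties using (all?; any?; ¬∀⟶∃¬; suc-injective)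
open import Data.Fin.Subset using (Subset; _∈_; _∉_; _⊂_; ⁅_⁆; ∣_∣; Empty) renaming (⊥ to ∅)
open import Data.Fin.Subset.Properties
  using (_∈?_; x∈⁅x⁆; x∈⁅y⁆⇒x≡y; x≢y⇒x∉⁅y⁆; ∉⊥; Empty-unique; ∣p∣≤n; p⊂q⇒∣p∣<∣q∣)
open import Data.List using (List; []; _∷_; _++_; [_]; _∷ʳ_; foldr; allFin; applyUpTo)
open import Data.List.Properties using (foldl-∷ʳ; applyUpTo-∷ʳ; ++-assoc)
open import Data.List.Membership.Propositional using () renaming (_∈_ to _∈ₗ_)
open import Data.List.Membership.Propositional.Properties using (∈-allFin)
import Data.List.Relation.Unary.All as All
open import Data.List.Relation.Unary.AllPairs using (AllPairs; []; _∷_)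
open import Data.List.Relation.Unary.Any using (here; there)
open import Data.List.Relation.Unary.Unique.Propositional.Properties using (allFin⁺)
open import Data.Nat using (ℕ; zero; suc; pred; _+_; _≤_; _<_; _≤′_; ≤′-refl; ≤′-step; z≤n; s≤s; z<s; s<s; >-nonZero⁻¹)
open import Data.Nat.Properties
  using (≤-refl; ≤-trans; <⇒≤; ≤-<-trans; ≰⇒>; 1+n≰n; ≤⇒≤′; n≤1+n; m≤n⇒m≤1+n;
         m≤m+n; m≤n+m; +-identityʳ; +-suc; +-mono-≤; +-mono-<-≤; +-mono-≤-<; +-monoʳ-<; module ≤-Reasoning)
open import Data.Product using (Σ; ∃; _×_; _,_; proj₁; proj₂)
open import Data.Sum using (_⊎_; inj₁; inj₂)
open import Data.Vec using (lookup; tabulate)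
open import Data.Vec.Properties using ([]=⇒lookup; lookup⇒[]=; lookup∘tabulate; ≡-dec)
open import Function using (_∘_)
open import Function.Bundles using (_⇔_; mk⇔; Equivalence)
open import Relation.Nullary using (¬_; Dec; yes; no; does)
open import Relation.Nullary.Decidable using (_×-dec_; _⊎-dec_; _→-dec_; ¬?; dec-true)
open import Relation.Binary.PropositionalEquality
  using (_≡_; _≢_; refl; sym; trans; cong; subst; module ≡-Reasoning)

∑ : ∀ {m} → (Fin m → ℕ) → ℕ
∑ {zero}  f = 0
∑ {suc m} f = f zero + ∑ (f ∘ suc)

∑-mono : ∀ {m} {f g : Fin m → ℕ} → (∀ i → f i ≤ g i) → ∑ f ≤ ∑ g
∑-mono {zero}  f≤g = z≤n
∑-mono {suc m} f≤g = +-mono-≤ (f≤g zero) (∑-mono (f≤g ∘ suc))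

∑-mono-< : ∀ {m} {f g : Fin m → ℕ} → (∀ i → f i ≤ g i) → ∀ j → f j < g j → ∑ f < ∑ g
∑-mono-< f≤g zero    fj<gj = +-mono-<-≤ fj<gj (∑-mono (f≤g ∘ suc))
∑-mono-< f≤g (suc j) fj<gj = +-mono-≤-< (f≤g zero) (∑-mono-< (f≤g ∘ suc) j fj<gj)

∑-term : ∀ {m} (f : Fin m → ℕ) j → f j ≤ ∑ f
∑-term f zero    = m≤m+n (f zero) _
∑-term f (suc j) = ≤-trans (∑-term (f ∘ suc) j) (m≤n+m _ (f zero))

∑-zero : ∀ {m} (f : Fin m → ℕ) → (∀ i → f i ≡ 0) → ∑ f ≡ 0
∑-zero {zero}  f f≡0 = refl
∑-zero {suc m} f f≡0 rewrite f≡0 zero = ∑-zero (f ∘ suc) (f≡0 ∘ suc)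

∑-single : ∀ {m} (f : Fin m → ℕ) j → (∀ i → i ≢ j → f i ≡ 0) → ∑ f ≡ f j
∑-single f zero    f≡0 rewrite ∑-zero (f ∘ suc) (λ i → f≡0 (suc i) λ ()) = +-identityʳ (f zero)
∑-single f (suc j) f≡0 rewrite f≡0 zero (λ ()) =
  ∑-single (f ∘ suc) j (λ i i≢j → f≡0 (suc i) (i≢j ∘ suc-injective))

∈⇒true : ∀ {m} {p : Fin m} {t : Subset m} → p ∈ t → lookup t p ≡ true
∈⇒true = []=⇒lookup

∉⇒false : ∀ {m} {p : Fin m} {t : Subset m} → p ∉ t → lookup t p ≡ false
∉⇒false {p = p} {t} p∉t with lookup t p in eq
... | true  = ⊥-elim (p∉t (lookup⇒[]= p t eq))
... | false = refl

does-true : ∀ {A : Set} (a? : Dec A) → does a? ≡ true → A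
does-true (yes a) _ = a

¬→-witness : ∀ {A B : Set} → Dec A → ¬ (A → B) → A × ¬ B
¬→-witness (yes a) ¬a→b = a , λ b → ¬a→b (λ _ → b)
¬→-witness (no ¬a) ¬a→b = ⊥-elim (¬a→b (⊥-elim ∘ ¬a))

choose : ∀ {k} {Q : Fin k → Set} → (∀ i → Dec (Q i)) → Fin k → Fin k
choose Q? default with any? Q?
... | yes (i , _) = i
... | no  _       = default

choose-spec : ∀ {k} {Q : Fin k → Set} (Q? : ∀ i → Dec (Q i)) default → ∃ Q → Q (choose Q? default)
choose-spec Q? default ∃Q with any? Q?
... | yes (_ , Qi) = Qi
... | no  ¬∃Q      = ⊥-elim (¬∃Q ∃Q)

_≟ᴾ_ : (p q : Player) → Dec (p ≡ q)
P1 ≟ᴾ P1 = yes refl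
P1 ≟ᴾ P2 = no λ ()
P2 ≟ᴾ P1 = no λ ()
P2 ≟ᴾ P2 = yes refl

module Occurrence (𝒩 : Arena) where
  open Arena 𝒩

  fireIf : Subset m → Choice 𝒩 → Atom 𝒩 → Marking 𝒩 → Marking 𝒩
  fireIf S c n y = if lookup S n then fire 𝒩 y n (c n) else y

  fold-unaffected : ∀ S c x a (l : List (Atom 𝒩)) → (∀ n → n ∈ₗ l → n ∈ S → a ∉ P n) →
                    foldr (fireIf S c) x l a ≡ x a
  fold-unaffected S c x a []      idle = refl
  fold-unaffected S c x a (n ∷ l) idle with lookup S n in n∈S
  ... | false = fold-unaffected S c x a l (λ n' → idle n' ∘ there)
  ... | true with lookup (P n) a in a∈Pn
  ...   | false = fold-unaffected S c x a l (λ n' → idle n' ∘ there)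
  ...   | true  = ⊥-elim (idle n (here refl) (lookup⇒[]= n S n∈S) (lookup⇒[]= a (P n) a∈Pn))

  fold-affected : ∀ S c x {a n} (l : List (Atom 𝒩)) → Independent 𝒩 S → n ∈ S → a ∈ P n →
                  n ∈ₗ l → foldr (fireIf S c) x l a ≡ X n a (c n)
  fold-affected S c x (n ∷ l) indep n∈S a∈Pn (here refl) rewrite ∈⇒true n∈S | ∈⇒true a∈Pn = refl
  fold-affected S c x {a} {n} (n' ∷ l) indep n∈S a∈Pn (there n∈l) with lookup S n' in n'∈S | n ≟ n'
  ... | false | _        = fold-affected S c x l indep n∈S a∈Pn n∈l
  ... | true  | yes refl rewrite ∈⇒true a∈Pn = refl
  ... | true  | no  n≢n'
    rewrite ∉⇒false (indep n n' n∈S (lookup⇒[]= n' S n'∈S) n≢n' a a∈Pn) =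
      fold-affected S c x l indep n∈S a∈Pn n∈l

  step-unaffected : ∀ x S c a → (∀ n → n ∈ S → a ∉ P n) → stepM 𝒩 x (S , c) a ≡ x a
  step-unaffected x S c a idle = fold-unaffected S c x a (allFin m) (λ n _ → idle n)

  step-affected : ∀ x S c {a n} → Independent 𝒩 S → n ∈ S → a ∈ P n → stepM 𝒩 x (S , c) a ≡ X n a (c n)
  step-affected x S c {n = n} indep n∈S a∈Pn = fold-affected S c x (allFin m) indep n∈S a∈Pn (∈-allFin n)

  step-cases : ∀ x S c a → Independent 𝒩 S →
               (Σ (Atom 𝒩) λ n → n ∈ S × a ∈ P n × stepM 𝒩 x (S , c) a ≡ X n a (c n))
               ⊎ stepM 𝒩 x (S , c) a ≡ x a
  step-cases x S c a indep with any? (λ n → (n ∈? S) ×-dec (a ∈? P n))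
  ... | yes (n , n∈S , a∈Pn) = inj₁ (n , n∈S , a∈Pn , step-affected x S c indep n∈S a∈Pn)
  ... | no  ¬party           = inj₂ (step-unaffected x S c a (λ n n∈S a∈Pn → ¬party (n , n∈S , a∈Pn)))

  reach-trans : ∀ {x y z} → Reach 𝒩 x y → Reach 𝒩 y z → Reach 𝒩 x z
  reach-trans done            y⇝z = y⇝z
  reach-trans (occ n r en x⇝y) y⇝z = occ n r en (reach-trans x⇝y y⇝z)

  -- Firing the atoms of a legal move one after the other is an occurrence
  -- sequence: by independence, atoms fired earlier leave later ones enabled.
  fold-reach : ∀ x S c (l : List (Atom 𝒩)) → AllPairs _≢_ l → Legal 𝒩 x S →
               Reach 𝒩 x (foldr (fireIf S c) x l)
  fold-reach x S c []      _                  _ = done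
  fold-reach x S c (n ∷ l) (n∉l ∷ distinct) legal@(_ , indep , enabled) with lookup S n in n∈S
  ... | false = fold-reach x S c l distinct legal
  ... | true  = reach-trans (fold-reach x S c l distinct legal) (occ n (c n) still-enabled done)
    where
    still-enabled : Enables 𝒩 (foldr (fireIf S c) x l) n
    still-enabled a a∈Pn
      rewrite fold-unaffected S c x a l
                (λ n' n'∈l n'∈S → indep n n' (lookup⇒[]= n S n∈S) n'∈S (All.lookup n∉l n'∈l) a a∈Pn)
      = enabled n (lookup⇒[]= n S n∈S) a a∈Pn

  legal-reach : ∀ {x S} c → Legal 𝒩 x S → Reach 𝒩 x (stepM 𝒩 x (S , c))
  legal-reach {x} {S} c = fold-reach x S c (allFin m) (allFin⁺ m)

  run-snoc : ∀ h mv → run 𝒩 (h ++ [ mv ]) ≡ stepM 𝒩 (run 𝒩 h) mv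
  run-snoc h mv = foldl-∷ʳ (stepM 𝒩) (x₀ 𝒩) mv h

  reach-snoc : ∀ h mv → Reach 𝒩 (x₀ 𝒩) (run 𝒩 h) → Legal 𝒩 (run 𝒩 h) (proj₁ mv) →
               Reach 𝒩 (x₀ 𝒩) (run 𝒩 (h ++ [ mv ]))
  reach-snoc h mv reach legal =
    subst (Reach 𝒩 (x₀ 𝒩)) (sym (run-snoc h mv)) (reach-trans reach (legal-reach (proj₂ mv) legal))

  singleton-independent : ∀ n → Independent 𝒩 ⁅ n ⁆
  singleton-independent n n₁ n₂ n₁∈ n₂∈ n₁≢n₂ =
    ⊥-elim (n₁≢n₂ (trans (x∈⁅y⁆⇒x≡y n n₁∈) (sym (x∈⁅y⁆⇒x≡y n n₂∈))))

  singleton-legal : ∀ {x n} → Enables 𝒩 x n → Legal 𝒩 x ⁅ n ⁆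
  singleton-legal {n = n} en =
    (n , x∈⁅x⁆ n) , singleton-independent n , (λ n' n'∈ → subst (Enables 𝒩 _) (sym (x∈⁅y⁆⇒x≡y n n'∈)) en)

  final-or-enabled : Sound 𝒩 → ∀ {x} → Reach 𝒩 (x₀ 𝒩) x → IsFinal 𝒩 x ⊎ ∃ (Enables 𝒩 x)
  final-or-enabled sound reach with proj₂ sound _ reach
  ... | _ , done           , final = inj₁ final
  ... | _ , occ n _ en _   , _     = inj₂ (n , en)

  X-nf-empty : ∀ {a} {r : Fin (R nf)} → a ∈ P nf → Empty (X nf a r)
  X-nf-empty {a} {r} a∈P = Equivalence.from (X-empty⇔nf nf a r a∈P) refl

  dead-step-fires-nf : Sound 𝒩 → ∀ {x} mv → Reach 𝒩 (x₀ 𝒩) x → Legal 𝒩 x (proj₁ mv) →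
                       Dead 𝒩 (stepM 𝒩 x mv) → nf ∈ proj₁ mv
  dead-step-fires-nf sound {x} (S , c) reach legal@((n , n∈S) , indep , _) dead
    with final-or-enabled sound (reach-trans reach (legal-reach c legal)) | P-nonempty n
  ... | inj₂ (n' , en) | _         = ⊥-elim (dead n' en)
  ... | inj₁ final     | a , a∈Pn = subst (_∈ S) (Equivalence.to (X-empty⇔nf n a (c n) a∈Pn) empty) n∈S
    where
    empty : Empty (X n a (c n))
    empty (p , p∈X) = ∉⊥ (subst (p ∈_) (trans (sym (step-affected x S c indep n∈S a∈Pn)) (final a)) p∈X)

  someOutcome : (n : Atom 𝒩) → Fin (R n)
  someOutcome n = fromℕ< (>-nonZero⁻¹ (R n) ⦃ R-nonzero n ⦄)

  someDeterministic : WeaklyDeterministic 𝒩 → ∃ (Deterministic 𝒩)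
  someDeterministic wd with P-nonempty n₀
  ... | a , a∈P with wd n₀ a (someOutcome n₀) a∈P
  ...   | b , b-det , _ = b , b-det

module Attractor (𝒩 : Arena) where
  open Arena 𝒩

  _≟ₛ_ : (t u : Subset m) → Dec (t ≡ u)
  _≟ₛ_ = ≡-dec Bool._≟_

  det? : ∀ a → Dec (Deterministic 𝒩 a)
  det? a = all? λ n → ¬? (n ≟ nf) →-dec ((a ∈? P n) →-dec all? λ r → any? λ n' → X n a r ≟ₛ ⁅ n' ⁆)

  attr?  : ∀ i n → Dec (Attr 𝒩 i n)
  lands? : ∀ i n r a → Dec (∀ n' → X n a r ≡ ⁅ n' ⁆ → Attr 𝒩 i n')
  ads?   : ∀ i n r → Dec (AllDetSucc 𝒩 i n r)
  attr? zero    n = n ≟ nf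
  attr? (suc i) n = attr? i n
                  ⊎-dec ((owner n ≟ᴾ P1) ×-dec any? (ads? i n))
                  ⊎-dec ((owner n ≟ᴾ P2) ×-dec all? (ads? i n))
  lands? i n r a = all? λ n' → X n a r ≟ₛ ⁅ n' ⁆ →-dec attr? i n'
  ads? i n r = all? λ a → (a ∈? P n) →-dec (det? a →-dec lands? i n r a)

  escape : ∀ {i n r} → ¬ AllDetSucc 𝒩 i n r →
           Σ (Agent 𝒩) λ a → a ∈ P n × Deterministic 𝒩 a ×
           Σ (Atom 𝒩) λ n' → X n a r ≡ ⁅ n' ⁆ × ¬ Attr 𝒩 i n'
  escape {i} {n} {r} ¬ads
    with a , ¬a-ok   ← ¬∀⟶∃¬ k _ (λ a → (a ∈? P n) →-dec (det? a →-dec lands? i n r a)) ¬ads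
    with a∈P , ¬a-ok ← ¬→-witness (a ∈? P n) ¬a-ok
    with a-det , ¬lands ← ¬→-witness (det? a) ¬a-ok
    with n' , ¬n'-ok ← ¬∀⟶∃¬ m _ (λ n' → X n a r ≟ₛ ⁅ n' ⁆ →-dec attr? i n') ¬lands
    with X≡ , n'∉ ← ¬→-witness (X n a r ≟ₛ ⁅ n' ⁆) ¬n'-ok
    = a , a∈P , a-det , n' , X≡ , n'∉

  attr-≤′ : ∀ {i j n} → i ≤′ j → Attr 𝒩 i n → Attr 𝒩 j n
  attr-≤′ ≤′-refl        a = a
  attr-≤′ (≤′-step i≤j) a = inj₁ (attr-≤′ i≤j a)

  attr-≤ : ∀ {i j n} → i ≤ j → Attr 𝒩 i n → Attr 𝒩 j n
  attr-≤ = attr-≤′ ∘ ≤⇒≤′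

  attr-lift : ∀ {i j} → (∀ n → Attr 𝒩 i n → Attr 𝒩 j n) → ∀ n → Attr 𝒩 (suc i) n → Attr 𝒩 (suc j) n
  attr-lift i⊆j n (inj₁ a)                    = inj₁ (i⊆j n a)
  attr-lift i⊆j n (inj₂ (inj₁ (o , r , ads))) = inj₂ (inj₁ (o , r , λ a a∈P a-det n' X≡ → i⊆j n' (ads a a∈P a-det n' X≡)))
  attr-lift i⊆j n (inj₂ (inj₂ (o , ads)))     = inj₂ (inj₂ (o , λ r a a∈P a-det n' X≡ → i⊆j n' (ads r a a∈P a-det n' X≡)))

  Stable : ℕ → Set
  Stable s = ∀ n → Attr 𝒩 (suc s) n → Attr 𝒩 s n

  stable-absorbs : ∀ {s} → Stable s → ∀ j n → Attr 𝒩 j n → Attr 𝒩 s n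
  stable-absorbs stable zero    n a = attr-≤ z≤n a
  stable-absorbs stable (suc j) n a = stable n (attr-lift (stable-absorbs stable j) n a)

  stable? : ∀ i → Dec (Stable i)
  stable? i = all? λ n → attr? (suc i) n →-dec attr? i n

  level : ℕ → Subset m
  level i = tabulate (λ n → does (attr? i n))

  ∈-level : ∀ {i n} → Attr 𝒩 i n → n ∈ level i
  ∈-level {i} {n} a = lookup⇒[]= n (level i) (trans (lookup∘tabulate _ n) (dec-true (attr? i n) a))

  level-attr : ∀ {i n} → n ∈ level i → Attr 𝒩 i n
  level-attr {i} {n} n∈ = does-true (attr? i n) (trans (sym (lookup∘tabulate _ n)) ([]=⇒lookup n∈))

  level-⊂ : ∀ i → ¬ Stable i → level i ⊂ level (suc i)
  level-⊂ i ¬stable with ¬∀⟶∃¬ m _ (λ n → attr? (suc i) n →-dec attr? i n) ¬stable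
  ... | n , ¬n-ok with ¬→-witness (attr? (suc i) n) ¬n-ok
  ...   | n∈next , n∉ = (λ {n} → ∈-level {suc i} {n} ∘ inj₁ ∘ level-attr) , n , ∈-level n∈next , n∉ ∘ level-attr {i}

  -- Searching upwards from level i: each unstable level adds an atom, and at
  -- most m atoms can be added, so the fuel never runs out.
  search : ∀ fuel i → i ≤ ∣ level i ∣ → m < fuel + i → ∃ Stable
  search zero        i grown bound = ⊥-elim (1+n≰n (≤-trans bound (≤-trans grown (∣p∣≤n (level i)))))
  search (suc fuel) i grown bound with stable? i
  ... | yes stable  = i , stable
  ... | no  ¬stable = search fuel (suc i) (≤-<-trans grown (p⊂q⇒∣p∣<∣q∣ (level-⊂ i ¬stable)))
                             (subst (m <_) (sym (+-suc fuel i)) bound)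

  stable-exists : ∃ Stable
  stable-exists = search (suc m) 0 z≤n (s≤s (m≤m+n m 0))

module Plays (𝒩 : Arena) (σ : Strategy 𝒩) where
  open Arena 𝒩
  open Occurrence 𝒩

  ConsistentMove : List (Move 𝒩) → Move 𝒩 → Set
  ConsistentMove h mv = Legal 𝒩 (run 𝒩 h) (proj₁ mv) × Agrees 𝒩 σ h mv

  infinite-play : (Good : List (Move 𝒩) → Set) → Good [] →
                  (∀ h → Good h → Σ (Move 𝒩) λ mv → ConsistentMove h mv × Good (h ++ [ mv ])) →
                  Σ (ℕ → Move 𝒩) (InfiniteConsistent 𝒩 σ)
  infinite-play Good good₀ extend = moves , consistent
    where
    state : ℕ → Σ (List (Move 𝒩)) Good
    state zero    = [] , good₀
    state (suc i) = proj₁ (state i) ++ [ proj₁ next ] , proj₂ (proj₂ next)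
      where next = extend (proj₁ (state i)) (proj₂ (state i))

    moves : ℕ → Move 𝒩
    moves i = proj₁ (extend (proj₁ (state i)) (proj₂ (state i)))

    history : ∀ i → applyUpTo moves i ≡ proj₁ (state i)
    history zero    = refl
    history (suc i) = begin
      applyUpTo moves (suc i)       ≡⟨ sym (applyUpTo-∷ʳ moves i) ⟩
      applyUpTo moves i ∷ʳ moves i  ≡⟨ cong (_∷ʳ moves i) (history i) ⟩
      proj₁ (state i) ∷ʳ moves i    ∎
      where open ≡-Reasoning

    consistent : InfiniteConsistent 𝒩 σ moves
    consistent i = subst (λ h → ConsistentMove h (moves i)) (sym (history i))
                         (proj₁ (proj₂ (extend (proj₁ (state i)) (proj₂ (state i)))))

  no-infinite-play : (Inv : Marking 𝒩 → Set) (Φ : Marking 𝒩 → ℕ) → Inv (x₀ 𝒩) →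
                     (∀ h mv → Inv (run 𝒩 h) → ConsistentMove h mv →
                        Inv (stepM 𝒩 (run 𝒩 h) mv) × Φ (stepM 𝒩 (run 𝒩 h) mv) < Φ (run 𝒩 h)) →
                     ∀ ms → ¬ InfiniteConsistent 𝒩 σ ms
  no-infinite-play Inv Φ inv₀ decrease ms consistent =
    1+n≰n (≤-trans (m≤m+n (suc (Φ (x₀ 𝒩))) _) (proj₂ (bound (suc (Φ (x₀ 𝒩))))))
    where
    x : ℕ → Marking 𝒩
    x i = run 𝒩 (applyUpTo ms i)

    x-suc : ∀ i → x (suc i) ≡ stepM 𝒩 (x i) (ms i)
    x-suc i = trans (cong (run 𝒩) (sym (applyUpTo-∷ʳ ms i))) (run-snoc (applyUpTo ms i) (ms i))

    bound : ∀ i → Inv (x i) × i + Φ (x i) ≤ Φ (x₀ 𝒩)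
    bound zero    = inv₀ , ≤-refl
    bound (suc i) =
        subst Inv (sym (x-suc i)) (proj₁ next)
      , subst (λ y → suc i + Φ y ≤ Φ (x₀ 𝒩)) (sym (x-suc i))
              (≤-trans (+-monoʳ-< i (proj₂ next)) (proj₂ (bound i)))
      where next = decrease (applyUpTo ms i) (ms i) (proj₁ (bound i)) (consistent i)

  last-move : ∀ past mv fut → Reach 𝒩 (x₀ 𝒩) (run 𝒩 past) → ConsistentFrom 𝒩 σ past (mv ∷ fut) →
              Σ (List (Move 𝒩)) λ init → Σ (Move 𝒩) λ last →
              past ++ mv ∷ fut ≡ init ++ [ last ] × Reach 𝒩 (x₀ 𝒩) (run 𝒩 init) × Legal 𝒩 (run 𝒩 init) (proj₁ last)
  last-move past mv []          reach (legal , _ , _)    = past , mv , refl , reach , legal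
  last-move past mv (mv' ∷ fut) reach (legal , _ , rest)
    with init , last , ≡init , reach' , legal' ← last-move (past ++ [ mv ]) mv' fut (reach-snoc past mv reach legal) rest
    = init , last , trans (sym (++-assoc past [ mv ] (mv' ∷ fut))) ≡init , reach' , legal'

  stuck-plays-end-with-nf : Sound 𝒩 → ∀ h → ConsistentFrom 𝒩 σ [] h → Dead 𝒩 (run 𝒩 h) → EndsWithNf 𝒩 h
  stuck-plays-end-with-nf sound []         _          dead = ⊥-elim (dead n₀ (λ _ _ → x∈⁅x⁆ n₀))
  stuck-plays-end-with-nf sound (mv ∷ fut) consistent dead
    with init , last , ≡init , reach , legal ← last-move [] mv fut done consistent
    = init , last , ≡init ,
      dead-step-fires-nf sound last reach legal (subst (Dead 𝒩) (trans (cong (run 𝒩) ≡init) (run-snoc init last)) dead)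

module Spoiler (𝒩 : Arena) (sound : Sound 𝒩) (wd : WeaklyDeterministic 𝒩)
               (s : ℕ) (stable : Attractor.Stable 𝒩 s) where
  open Arena 𝒩
  open Occurrence 𝒩
  open Attractor 𝒩

  spoil : (n : Atom 𝒩) → Fin (R n)
  spoil n = choose (λ r → ¬? (ads? s n r)) (someOutcome n)

  against : Strategy 𝒩 → List (Move 𝒩) → Subset m → Choice 𝒩
  against σ h S n with owner n
  ... | P1 = σ h S n
  ... | P2 = spoil n

  against-agrees : ∀ σ h S → Agrees 𝒩 σ h (S , against σ h S)
  against-agrees σ h S n _ owner≡P1 rewrite owner≡P1 = refl

  -- Outside 𝒜, no outcome chosen against σ keeps all deterministic parties in
  -- 𝒜: on N₁ because 𝒜 is stable, on N₂ by the choice of spoil.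
  against-escapes : ∀ σ h S n → ¬ Attr 𝒩 s n → ¬ AllDetSucc 𝒩 s n (against σ h S n)
  against-escapes σ h S n n∉𝒜 with owner n in owner≡
  ... | P1 = λ ads → n∉𝒜 (stable n (inj₂ (inj₁ (owner≡ , _ , ads))))
  ... | P2 = choose-spec (λ r → ¬? (ads? s n r)) (someOutcome n)
               (¬∀⟶∃¬ (R n) _ (ads? s n) (λ ads → n∉𝒜 (stable n (inj₂ (inj₂ (owner≡ , ads))))))

  Trapped : Marking 𝒩 → Set
  Trapped x = Σ (Agent 𝒩) λ d → Deterministic 𝒩 d × Σ (Atom 𝒩) λ p → x d ≡ ⁅ p ⁆ × ¬ Attr 𝒩 s p

  trapped-not-final : ∀ {x} → Trapped x → ¬ IsFinal 𝒩 x
  trapped-not-final (d , _ , p , xd≡ , _) final = ∉⊥ (subst (p ∈_) (trans (sym xd≡) (final d)) (x∈⁅x⁆ p))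

  -- Firing a single enabled atom with escaping outcomes keeps some agent trapped:
  -- if the trapped atom p fires, one of its deterministic parties escapes to a
  -- new atom outside 𝒜; otherwise the trapped agent is not involved.
  stays-trapped : ∀ x n c → Enables 𝒩 x n → (∀ n → ¬ Attr 𝒩 s n → ¬ AllDetSucc 𝒩 s n (c n)) →
                  Trapped x → Trapped (stepM 𝒩 x (⁅ n ⁆ , c))
  stays-trapped x n c en escapes (d , d-det , p , xd≡ , p∉𝒜) with n ≟ p
  ... | yes refl with a , a∈P , a-det , n' , X≡ , n'∉𝒜 ← escape (escapes p p∉𝒜) =
        a , a-det , n' , trans (step-affected x ⁅ p ⁆ c (singleton-independent p) (x∈⁅x⁆ p) a∈P) X≡ , n'∉𝒜
  ... | no n≢p = d , d-det , p , trans (step-unaffected x ⁅ n ⁆ c d d-idle) xd≡ , p∉𝒜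
    where
    d-idle : ∀ n' → n' ∈ ⁅ n ⁆ → d ∉ P n'
    d-idle n' n'∈ d∈P = n≢p (x∈⁅y⁆⇒x≡y p (subst (n ∈_) xd≡ (en d (subst (λ z → d ∈ P z) (x∈⁅y⁆⇒x≡y n n'∈) d∈P))))

  module _ (σ : Strategy 𝒩) where
    open Plays 𝒩 σ

    Spoiled : List (Move 𝒩) → Set
    Spoiled h = Reach 𝒩 (x₀ 𝒩) (run 𝒩 h) × Trapped (run 𝒩 h)

    -- By soundness a trapped reachable marking enables some atom; Scheduler fires it alone.
    spoiling-move : ∀ h → Spoiled h → Σ (Move 𝒩) λ mv → ConsistentMove h mv × Spoiled (h ++ [ mv ])
    spoiling-move h (reach , trapped) with final-or-enabled sound reach
    ... | inj₁ final    = ⊥-elim (trapped-not-final trapped final)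
    ... | inj₂ (n , en) =
        mv , (singleton-legal en , against-agrees σ h ⁅ n ⁆)
      , reach-snoc h mv reach (singleton-legal en)
      , subst Trapped (sym (run-snoc h mv))
              (stays-trapped (run 𝒩 h) n (against σ h ⁅ n ⁆) en (against-escapes σ h ⁅ n ⁆) trapped)
      where mv = ⁅ n ⁆ , against σ h ⁅ n ⁆

  player1-wins⇒attractor : Player1Wins 𝒩 → InAttractor 𝒩 n₀
  player1-wins⇒attractor (σ , no-infinite , _) with attr? s n₀
  ... | yes n₀∈𝒜 = s , n₀∈𝒜
  ... | no  n₀∉𝒜 with b , b-det ← someDeterministic wd =
        ⊥-elim (no-infinite _ (proj₂ (infinite-play (Spoiled σ) (done , b , b-det , n₀ , refl , n₀∉𝒜) (spoiling-move σ))))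
    where open Plays 𝒩 σ

module AttractorStrategy (𝒩 : Arena) (sound : Sound 𝒩) (wd : WeaklyDeterministic 𝒩)
                         (s : ℕ) (stable : Attractor.Stable 𝒩 s) where
  open Arena 𝒩
  open Occurrence 𝒩
  open Attractor 𝒩

  -- The least level below j containing p (meaningful when p ∈ Attr j).
  leastLevel : ℕ → Atom 𝒩 → ℕ
  leastLevel zero    p = zero
  leastLevel (suc j) p with attr? j p
  ... | yes _ = leastLevel j p
  ... | no  _ = suc j

  leastLevel-≤ : ∀ j p → leastLevel j p ≤ j
  leastLevel-≤ zero    p = z≤n
  leastLevel-≤ (suc j) p with attr? j p
  ... | yes _ = m≤n⇒m≤1+n (leastLevel-≤ j p)
  ... | no  _ = ≤-refl

  leastLevel-attr : ∀ j p → Attr 𝒩 j p → Attr 𝒩 (leastLevel j p) p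
  leastLevel-attr zero    p p∈ = p∈
  leastLevel-attr (suc j) p p∈ with attr? j p
  ... | yes p∈j = leastLevel-attr j p p∈j
  ... | no  _   = p∈

  leastLevel-least : ∀ j p {i} → Attr 𝒩 i p → leastLevel j p ≤ i
  leastLevel-least zero    p p∈ = z≤n
  leastLevel-least (suc j) p p∈ with attr? j p
  ... | yes _   = leastLevel-least j p p∈
  ... | no  p∉j = ≰⇒> (λ i≤j → p∉j (attr-≤ i≤j p∈))

  rank : Atom 𝒩 → ℕ
  rank = leastLevel s

  attract : (n : Atom 𝒩) → Fin (R n)
  attract n = choose (ads? (pred (rank n)) n) (someOutcome n)

  -- At a least level q of an atom n ≠ n_f one of the proper attractor clauses
  -- applies, so every outcome compatible with the choice of Player 1 sends
  -- the deterministic parties of n into level q - 1.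
  descends : ∀ q {n r} → Attr 𝒩 q n → (∀ {i} → Attr 𝒩 i n → q ≤ i) → n ≢ nf →
             (owner n ≡ P1 → r ≡ choose (ads? (pred q) n) (someOutcome n)) →
             Σ ℕ λ i → suc i ≡ q × AllDetSucc 𝒩 i n r
  descends zero    n≡nf                      _     n≢nf _ = ⊥-elim (n≢nf n≡nf)
  descends (suc i) (inj₁ n∈i)                least _    _ = ⊥-elim (1+n≰n (least n∈i))
  descends (suc i) {n} (inj₂ (inj₁ (owner≡P1 , r' , ads))) _ _ follows =
    i , refl , subst (AllDetSucc 𝒩 i n) (sym (follows owner≡P1)) (choose-spec (ads? i n) _ (r' , ads))
  descends (suc i) {r = r} (inj₂ (inj₂ (_ , ads))) _ _ _ = i , refl , ads r

  det-successor : ∀ {n r a} → Attr 𝒩 s n → (owner n ≡ P1 → r ≡ attract n) → a ∈ P n → Deterministic 𝒩 a →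
                  X n a r ≡ ∅ ⊎ Σ (Atom 𝒩) λ n' → X n a r ≡ ⁅ n' ⁆ × Attr 𝒩 s n' × rank n' < rank n
  det-successor {n} {r} {a} n∈𝒜 follows a∈P a-det with n ≟ nf
  ... | yes refl = inj₁ (Empty-unique (X-nf-empty a∈P))
  ... | no  n≢nf
    with n' , X≡ ← a-det n n≢nf a∈P r
    with i , i+1≡rank , ads ← descends (rank n) (leastLevel-attr s n n∈𝒜) (leastLevel-least s n) n≢nf follows
    = inj₂ (n' , X≡ , attr-≤ i≤s n'∈i , subst (rank n' <_) i+1≡rank (s≤s (leastLevel-least s n' n'∈i)))
    where
    n'∈i = ads a a∈P a-det n' X≡
    i≤s  = ≤-trans (n≤1+n i) (subst (_≤ s) (sym i+1≡rank) (leastLevel-≤ s n))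

  weight : Atom 𝒩 → ℕ
  weight p = suc (rank p)

  weightIn : Subset m → Atom 𝒩 → ℕ
  weightIn t p = if lookup t p then weight p else 0

  setWeight : Subset m → ℕ
  setWeight t = ∑ (weightIn t)

  weightIn-∈ : ∀ {t p} → p ∈ t → weightIn t p ≡ weight p
  weightIn-∈ {p = p} p∈t = cong (λ b → if b then weight p else 0) (∈⇒true p∈t)

  weightIn-∉ : ∀ {t p} → p ∉ t → weightIn t p ≡ 0
  weightIn-∉ {p = p} p∉t = cong (λ b → if b then weight p else 0) (∉⇒false p∉t)

  setWeight-∈ : ∀ {t p} → p ∈ t → weight p ≤ setWeight t
  setWeight-∈ {t} {p} p∈t = subst (_≤ setWeight t) (weightIn-∈ p∈t) (∑-term (weightIn t) p)

  setWeight-∅ : setWeight ∅ ≡ 0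
  setWeight-∅ = ∑-zero (weightIn ∅) (λ p → weightIn-∉ {∅} {p} ∉⊥)

  setWeight-⁅⁆ : ∀ p → setWeight ⁅ p ⁆ ≡ weight p
  setWeight-⁅⁆ p = trans (∑-single _ p (λ q q≢p → weightIn-∉ (x≢y⇒x∉⁅y⁆ q≢p))) (weightIn-∈ (x∈⁅x⁆ p))

  agentWeight : Agent 𝒩 → Subset m → ℕ
  agentWeight a t with det? a
  ... | yes _ = setWeight t
  ... | no  _ = 0

  potential : Marking 𝒩 → ℕ
  potential x = ∑ λ a → agentWeight a (x a)

  record Invariant (x : Marking 𝒩) : Set where
    field
      det-party : ∀ a n → n ∈ x a → Σ (Agent 𝒩) λ b → Deterministic 𝒩 b × b ∈ P n
      in-𝒜      : ∀ a → Deterministic 𝒩 a → ∀ p → p ∈ x a → Attr 𝒩 s p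
  open Invariant

  Follows : Marking 𝒩 → Move 𝒩 → Set
  Follows x (S , c) = Legal 𝒩 x S × (∀ n → n ∈ S → owner n ≡ P1 → c n ≡ attract n)

  invariant-x₀ : Attr 𝒩 s n₀ → Invariant (x₀ 𝒩)
  invariant-x₀ n₀∈𝒜 with b , b-det ← someDeterministic wd = record
    { det-party = λ _ n n∈ → b , b-det , subst (λ z → b ∈ P z) (sym (x∈⁅y⁆⇒x≡y n₀ n∈)) (n₀-all b)
    ; in-𝒜      = λ _ _ p p∈ → subst (Attr 𝒩 s) (sym (x∈⁅y⁆⇒x≡y n₀ p∈)) n₀∈𝒜
    }

  invariant-step : ∀ {x} mv → Invariant x → Follows x mv → Invariant (stepM 𝒩 x mv)
  invariant-step {x} (S , c) inv ((_ , indep , enabled) , follows) =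
    record { det-party = det-party′ ; in-𝒜 = in-𝒜′ }
    where
    det-party′ : ∀ a n' → n' ∈ stepM 𝒩 x (S , c) a → Σ (Agent 𝒩) λ b → Deterministic 𝒩 b × b ∈ P n'
    det-party′ a n' n'∈ with step-cases x S c a indep
    ... | inj₂ same = det-party inv a n' (subst (n' ∈_) same n'∈)
    ... | inj₁ (n , n∈S , a∈P , moved) with b , b-det , b∈P ← wd n a (c n) a∈P =
          b , b-det , b∈P n' (subst (n' ∈_) moved n'∈)

    in-𝒜′ : ∀ a → Deterministic 𝒩 a → ∀ p → p ∈ stepM 𝒩 x (S , c) a → Attr 𝒩 s p
    in-𝒜′ a a-det p p∈ with step-cases x S c a indep
    ... | inj₂ same = in-𝒜 inv a a-det p (subst (p ∈_) same p∈)
    ... | inj₁ (n , n∈S , a∈P , moved)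
      with det-successor (in-𝒜 inv a a-det n (enabled n n∈S a a∈P)) (follows n n∈S) a∈P a-det
    ...   | inj₁ X≡∅ = ⊥-elim (∉⊥ (subst (p ∈_) (trans moved X≡∅) p∈))
    ...   | inj₂ (n' , X≡ , n'∈𝒜 , _) = subst (Attr 𝒩 s) (sym (x∈⁅y⁆⇒x≡y n' (subst (p ∈_) (trans moved X≡) p∈))) n'∈𝒜

  setWeight-drops : ∀ {x n r a} → Invariant x → n ∈ x a → (owner n ≡ P1 → r ≡ attract n) →
                    a ∈ P n → Deterministic 𝒩 a → setWeight (X n a r) < setWeight (x a)
  setWeight-drops {x} {n} {r} {a} inv n∈xa follows a∈P a-det
    with det-successor (in-𝒜 inv a a-det n n∈xa) follows a∈P a-det
  ... | inj₁ X≡∅ = begin-strict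
    setWeight (X n a r)  ≡⟨ cong setWeight X≡∅ ⟩
    setWeight ∅          ≡⟨ setWeight-∅ ⟩
    0                    <⟨ z<s ⟩
    weight n             ≤⟨ setWeight-∈ n∈xa ⟩
    setWeight (x a)      ∎
    where open ≤-Reasoning
  ... | inj₂ (n' , X≡ , _ , smaller) = begin-strict
    setWeight (X n a r)  ≡⟨ cong setWeight X≡ ⟩
    setWeight ⁅ n' ⁆     ≡⟨ setWeight-⁅⁆ n' ⟩
    weight n'            <⟨ s<s smaller ⟩
    weight n             ≤⟨ setWeight-∈ n∈xa ⟩
    setWeight (x a)      ∎
    where open ≤-Reasoning

  agentWeight-≤ : ∀ {x} mv → Invariant x → Follows x mv → ∀ a →
                  agentWeight a (stepM 𝒩 x mv a) ≤ agentWeight a (x a)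
  agentWeight-≤ {x} (S , c) inv ((_ , indep , enabled) , follows) a with step-cases x S c a indep
  ... | inj₂ same rewrite same = ≤-refl
  ... | inj₁ (n , n∈S , a∈P , moved) rewrite moved with det? a
  ...   | yes a-det = <⇒≤ (setWeight-drops inv (enabled n n∈S a a∈P) (follows n n∈S) a∈P a-det)
  ...   | no  _     = ≤-refl

  agentWeight-< : ∀ {x} mv → Invariant x → Follows x mv → ∀ {n b} → n ∈ proj₁ mv → b ∈ P n →
                  Deterministic 𝒩 b → agentWeight b (stepM 𝒩 x mv b) < agentWeight b (x b)
  agentWeight-< {x} (S , c) inv ((_ , indep , enabled) , follows) {n} {b} n∈S b∈P b-det
    rewrite step-affected x S c indep n∈S b∈P with det? b
  ... | yes _     = setWeight-drops inv (enabled n n∈S b b∈P) (follows n n∈S) b∈P b-det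
  ... | no  ¬det = ⊥-elim (¬det b-det)

  -- Every move fires some atom, which has a deterministic party; so the potential drops.
  potential-drops : ∀ {x} mv → Invariant x → Follows x mv → potential (stepM 𝒩 x mv) < potential x
  potential-drops mv inv ok@(((n , n∈S) , _ , enabled) , _) with a , a∈P ← P-nonempty n
    with b , b-det , b∈P ← det-party inv a n (enabled n n∈S a a∈P)
    = ∑-mono-< (agentWeight-≤ mv inv ok) b (agentWeight-< mv inv ok n∈S b∈P b-det)

  attract-strategy : Strategy 𝒩
  attract-strategy _ _ = attract

  attractor⇒player1-wins : InAttractor 𝒩 n₀ → Player1Wins 𝒩
  attractor⇒player1-wins (j , n₀∈j) =
    attract-strategy ,
    no-infinite-play Invariant potential (invariant-x₀ (stable-absorbs stable j n₀ n₀∈j))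
      (λ h mv inv ok → invariant-step mv inv ok , potential-drops mv inv ok) ,
    stuck-plays-end-with-nf sound
    where open Plays 𝒩 attract-strategy

theorem4 : (𝒩 : Arena) → Sound 𝒩 → WeaklyDeterministic 𝒩 →
           (Player1Wins 𝒩 ⇔ InAttractor 𝒩 (Arena.n₀ 𝒩))
theorem4 𝒩 sound wd with s , stable ← Attractor.stable-exists 𝒩 =
  mk⇔ (Spoiler.player1-wins⇒attractor 𝒩 sound wd s stable)
      (AttractorStrategy.attractor⇒player1-wins 𝒩 sound wd s stable)
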